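{- There is no simple connected graph $G$ with $md(G)=2$.
   Context: For vertices $u,v$ of a connected graph $G$, $d(u,v)$ is the length of a shortest $u$–$v$ path. For $W\subseteq V(G)$ and $v\in V(G)$, $r_m(v|W)$ is the multiset $\{d(v,w): w\in W\}$. $W$ is an m-resolving set if $r_m(u|W)\neq r_m(v|W)$ for all distinct $u,v\in V(G)$. If $G$ has an m-resolving set, $md(G)$ is the minimum cardinality of one; otherwise $md(G)=\infty$. -}

module Defs where

open import Data.Nat using (ℕ; zero; suc; _<_; _≤_)
open import Data.Fin using (Fin)
open import Data.List using (List; map; length)
open import Data.List.Relation.Unary.Unique.Propositional using (Unique)
open import Data.List.Relation.Binary.Permutation.Propositional using (_↭_)
open import Data.Product using (Σ; _×_; ∃)
open import Relation.Nullary using (¬_)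
open import Relation.Binary.PropositionalEquality using (_≡_)

record Graph (n : ℕ) : Set₁ where
  field
    Adj   : Fin n → Fin n → Set
    sym   : ∀ {u v} → Adj u v → Adj v u
    irrefl : ∀ {u} → ¬ Adj u u
open Graph public

data Walk {n : ℕ} (G : Graph n) : ℕ → Fin n → Fin n → Set where
  here : ∀ {u} → Walk G zero u u
  step : ∀ {k u v w} → Adj G u v → Walk G k v w → Walk G (suc k) u w

Connected : ∀ {n} → Graph n → Set
Connected G = ∀ u v → ∃ λ k → Walk G k u v

-- d(u,v) = k : k is the length of a shortest u–v walk (equivalently path).
IsDist : ∀ {n} → Graph n → Fin n → Fin n → ℕ → Set
IsDist G u v k = Walk G k u v × (∀ j → j < k → ¬ Walk G j u v)

-- Given the distance function d of G, r_m(v|W) as a list (multiset) of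
-- distances; multiset equality is equality up to permutation.
rm : ∀ {n} → (Fin n → Fin n → ℕ) → Fin n → List (Fin n) → List ℕ
rm d v W = map (d v) W

MResolving : ∀ {n} → (Fin n → Fin n → ℕ) → List (Fin n) → Set
MResolving d W = ∀ u v → ¬ u ≡ v → ¬ (rm d u W ↭ rm d v W)

MdEq : ∀ {n} → (Fin n → Fin n → ℕ) → ℕ → Set
MdEq {n} d k =
  (Σ (List (Fin n)) λ W → Unique W × length W ≡ k × MResolving d W)
  × (∀ (W : List (Fin n)) → Unique W → MResolving d W → k ≤ length W)

module Submission where

-- An m-resolving set of size 2 is a pair W = {a , b} of
-- distinct vertices.  Since d(a,a) = d(b,b) = 0 and d(a,b) = d(b,a),
--   r_m(a | W) = {0 , d(a,b)}  and  r_m(b | W) = {d(b,a) , 0}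
-- are the same multiset, so W does not separate a from b.

open import Defs
open import Data.Nat using (ℕ; zero; suc; z≤n; s≤s)
open import Data.Nat.Properties using (<-cmp)
open import Data.Fin using (Fin)
open import Data.List using ([]; _∷_)
open import Data.List.Relation.Unary.AllPairs using (_∷_)
open import Data.List.Relation.Unary.All using ([]; _∷_)
open import Data.List.Relation.Binary.Permutation.Propositional using (_↭_; swap; refl)
open import Data.Product using (_,_; proj₁; proj₂)
open import Relation.Binary using (tri<; tri≈; tri>)
open import Relation.Binary.PropositionalEquality using (_≡_; refl)
open import Relation.Nullary using (¬_)
open import Data.Empty using (⊥-elim)

module _ {n : ℕ} {G : Graph n} where

  snocWalk : ∀ {k u v w} → Walk G k u v → Adj G v w → Walk G (suc k) u w
  snocWalk here       e = step e here
  snocWalk (step a p) e = step a (snocWalk p e)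

  reverseWalk : ∀ {k u v} → Walk G k u v → Walk G k v u
  reverseWalk here       = here
  reverseWalk (step a p) = snocWalk (reverseWalk p) (Graph.sym G a)

module _ {n : ℕ} (G : Graph n) (d : Fin n → Fin n → ℕ)
         (isDist : ∀ u v → IsDist G u v (d u v)) where

  dist-self : ∀ a → d a a ≡ 0
  dist-self a with d a a | isDist a a
  ... | zero  | _              = refl
  ... | suc k | (_ , minimal) = ⊥-elim (minimal 0 (s≤s z≤n) here)

  -- d(a,b) = d(b,a): reversing a shortest walk in one direction gives a
  -- walk of the same length in the other, so neither distance is smaller.
  dist-sym : ∀ a b → d a b ≡ d b a
  dist-sym a b with <-cmp (d a b) (d b a)
  ... | tri< lt _ _ = ⊥-elim (proj₂ (isDist b a) (d a b) lt (reverseWalk (proj₁ (isDist a b))))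
  ... | tri≈ _ eq _ = eq
  ... | tri> _ _ gt = ⊥-elim (proj₂ (isDist a b) (d b a) gt (reverseWalk (proj₁ (isDist b a))))

  pair-multisets-agree : ∀ a b → rm d a (a ∷ b ∷ []) ↭ rm d b (a ∷ b ∷ [])
  pair-multisets-agree a b
    rewrite dist-self a | dist-self b | dist-sym a b = swap 0 (d b a) refl

  pair-not-resolving : ∀ a b → ¬ a ≡ b → ¬ MResolving d (a ∷ b ∷ [])
  pair-not-resolving a b a≢b resolving =
    resolving a b a≢b (pair-multisets-agree a b)

lemma2p6 : (n : ℕ) (G : Graph n) → Connected G →
           (d : Fin n → Fin n → ℕ) → (∀ u v → IsDist G u v (d u v)) →
           ¬ MdEq d 2
lemma2p6 n G _ d isDist ((a ∷ b ∷ [] , (a≢b ∷ []) ∷ _ , refl , resolving) , _) =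
  pair-not-resolving G d isDist a b a≢b resolving
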